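{- Let $n\ge1$ and let $z_1,\ldots,z_n\in\mathbb{C}$ satisfy $z_1+\cdots+z_n=1$. Then for all integers $s_1,\ldots,s_n\ge0$, $$\sum_{k=1}^{n} z_k^{s_k+1}\sum_{\substack{0\le j_i\le s_i\\ i\ne k}}\frac{\big(s_k+\sum_{i\ne k}j_i\big)!}{s_k!\prod_{i\ne k}j_i!}\prod_{i\ne k}z_i^{j_i}=1,$$ where the inner sum runs over all $(j_i)_{i\ne k}$ with $0\le j_i\le s_i$. -}

module Defs where

open import Level using (Level)
open import Data.Nat using (ℕ; zero; suc; _/_; NonZero; _!) renaming (_+_ to _+ℕ_; _*_ to _*ℕ_)
open import Data.Nat.Properties using (_!≢0; m*n≢0)
open import Data.Fin using (Fin; _≟_)
open import Data.List using (List; []; _∷_; [_]; map; concatMap; filter; upTo; allFin; foldr)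
open import Data.Bool using (if_then_else_)
open import Relation.Nullary using (¬?)
open import Relation.Nullary.Decidable using (⌊_⌋)
open import Algebra.Bundles using (CommutativeRing)
import Algebra.Properties.Semiring.Mult as Mult

prodFact : List ℕ → ℕ
prodFact []      = 1
prodFact (j ∷ l) = j ! *ℕ prodFact l

prodFact-nz : ∀ l → NonZero (prodFact l)
prodFact-nz []      = _
prodFact-nz (j ∷ l) = m*n≢0 (j !) (prodFact l) {{j !≢0}} {{prodFact-nz l}}

sumℕ : List ℕ → ℕ
sumℕ = foldr _+ℕ_ 0

-- multinomial coefficient  (a + Σ l)! / (a! ∏_{j ∈ l} j!)   (exact division)
multinomial : ℕ → List ℕ → ℕ
multinomial a l = (a +ℕ sumℕ l) ! / (a ! *ℕ prodFact l)
  where instance _ = m*n≢0 (a !) (prodFact l) {{a !≢0}} {{prodFact-nz l}}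

others : ∀ {n} → Fin n → List (Fin n)
others k = filter (λ i → ¬? (i ≟ k)) (allFin _)

update : ∀ {n} → (Fin n → ℕ) → Fin n → ℕ → (Fin n → ℕ)
update j i a x = if ⌊ x ≟ i ⌋ then a else j x

-- all tuples (j_i)_{i ∈ is} with 0 ≤ j_i ≤ s_i, represented as functions
-- Fin n → ℕ which are 0 outside is (each tuple listed exactly once when
-- is has no repetitions).
tuples : ∀ {n} → (Fin n → ℕ) → List (Fin n) → List (Fin n → ℕ)
tuples s []       = [ (λ _ → 0) ]
tuples s (i ∷ is) = concatMap (λ j → map (update j i) (upTo (suc (s i)))) (tuples s is)

module _ {c ℓ : Level} (R : CommutativeRing c ℓ) where
  open CommutativeRing R
  open Mult semiring using (_×_)

  sumR : List Carrier → Carrier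
  sumR = foldr _+_ 0#

  prodR : List Carrier → Carrier
  prodR = foldr _*_ 1#

  pow : Carrier → ℕ → Carrier
  pow x zero    = 1#
  pow x (suc m) = x * pow x m

  innerSum : ∀ {n} → (Fin n → Carrier) → (Fin n → ℕ) → Fin n → Carrier
  innerSum z s k =
    sumR (map (λ j → (multinomial (s k) (map j (others k)) × 1#)
                     * prodR (map (λ i → pow (z i) (j i)) (others k)))
              (tuples s (others k)))

  lhs : ∀ {n} → (Fin n → Carrier) → (Fin n → ℕ) → Carrier
  lhs z s = sumR (map (λ k → pow (z k) (suc (s k)) * innerSum z s k) (allFin _))

module Submission where

-- Write ((b multichoose p)) = C(b+p-1, p) for the number of multisets of size p
-- drawn from b elements; the coefficient of z^j in (1 - Σ z_i)^(-b) is the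
-- product of such numbers.  For a list L of distinct indices put y_L = Σ_{i∈L} z_i,
-- let H_L(b) be the truncation of (1 - y_L)^(-b) to the exponents j_i ≤ s_i, and
-- let S_L(b) = Σ_{k∈L} z_k^(s_k+1) ((b multichoose s_k)) H_{L∖k}(b + s_k) collect
-- the monomials that overflow the box when H_L(b) is multiplied by y_L.  In any
-- commutative ring, with no hypothesis on z,
--        H_L(b+1) + S_L(b+1) ≈ H_L(b) + y_L · H_L(b+1)                 (balanced)
-- by induction on L: expanding along the first index r, one side is summation by
-- parts in the exponent of z_r (Pascal's rule for multiset coefficients), the
-- other an exchange of summations that uses the symmetry
-- ((b multichoose p))((b+p multichoose q)) = ((b multichoose q))((b+q multichoose p)).
-- For L = {1..n} and b = 0 we have H_L(0) = 1 and y_L = 1, hence S_L(1) = 1; and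
-- S_L(1) is the left-hand side of the theorem, because the inner sum for k is
-- H_{L∖k}(s_k + 1) once the multinomial coefficients are factored into multiset
-- coefficients.

open import Defs
open import Data.Nat using (ℕ; zero; suc; _≤_; _!; NonZero)
import Data.Nat.Properties as ℕₚ
open import Data.Nat.Properties using (_!≢0; m*n≢0)
open import Data.Nat.DivMod using (m*n/n≡m; /-congˡ)
open import Data.Nat.Tactic.RingSolver using (solve-∀)
open import Data.Fin using (Fin; _≟_)
open import Data.List using (List; []; _∷_; _++_; _∷ʳ_; [_]; map; concatMap; filter; upTo; applyUpTo; allFin)
import Data.List.Properties as Listₚ
open import Data.List.Relation.Unary.All as All using (All; []; _∷_)
import Data.List.Relation.Unary.All.Properties as Allₚ
open import Data.List.Relation.Unary.AllPairs using ([]; _∷_)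
open import Data.List.Relation.Unary.Unique.Propositional using (Unique)
import Data.List.Relation.Unary.Unique.Propositional.Properties as Uniqueₚ
open import Relation.Nullary using (¬?; yes; no)
open import Data.Empty using (⊥-elim)
open import Algebra.Bundles using (CommutativeRing)
open import Relation.Binary.PropositionalEquality as Eq using (_≡_; _≢_)

module Multichoose where
  open Data.Nat using (_+_; _*_)
  open Eq using (refl; cong; cong₂; sym; trans)
  open Eq.≡-Reasoning

  multichoose : ℕ → ℕ → ℕ
  multichoose zero    zero    = 1
  multichoose zero    (suc p) = 0
  multichoose (suc b) zero    = 1
  multichoose (suc b) (suc p) = multichoose b (suc p) + multichoose (suc b) p

  multichoose-zeroʳ : ∀ b → multichoose b 0 ≡ 1
  multichoose-zeroʳ zero    = refl
  multichoose-zeroʳ (suc b) = refl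

  multichoose-one : ∀ p → multichoose 1 p ≡ 1
  multichoose-one zero    = refl
  multichoose-one (suc p) = multichoose-one p

  multichoose-fact : ∀ c p → multichoose (suc c) p * (c ! * p !) ≡ (c + p) !
  multichoose-fact c zero = begin
    1 * (c ! * 1)  ≡⟨ trans (ℕₚ.*-identityˡ _) (ℕₚ.*-identityʳ _) ⟩
    c !            ≡⟨ cong _! (sym (ℕₚ.+-identityʳ c)) ⟩
    (c + 0) !      ∎
  multichoose-fact zero (suc p) = begin
    multichoose 1 (suc p) * (1 * suc p !)  ≡⟨ cong (_* (1 * suc p !)) (multichoose-one (suc p)) ⟩
    1 * (1 * suc p !)                      ≡⟨ trans (ℕₚ.*-identityˡ _) (ℕₚ.*-identityˡ _) ⟩
    suc p !                                ∎
  multichoose-fact (suc c) (suc p) = begin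
    (X + Y) * ((suc c * c !) * (suc p * p !))
      ≡⟨ regroup X Y c p (c !) (p !) ⟩
    suc c * (X * (c ! * suc p !)) + suc p * (Y * (suc c ! * p !))
      ≡⟨ cong₂ (λ u v → suc c * u + suc p * v) (multichoose-fact c (suc p)) (multichoose-fact (suc c) p) ⟩
    suc c * (c + suc p) ! + suc p * suc (c + p) !
      ≡⟨ cong (λ t → suc c * (c + suc p) ! + suc p * t !) (sym (ℕₚ.+-suc c p)) ⟩
    suc c * (c + suc p) ! + suc p * (c + suc p) !
      ≡⟨ collect c p ((c + suc p) !) ⟩
    suc (c + suc p) * (c + suc p) !
      ∎
    where
    X = multichoose (suc c) (suc p)
    Y = multichoose (suc (suc c)) p
    regroup : ∀ X Y c p C P → (X + Y) * ((suc c * C) * (suc p * P))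
            ≡ suc c * (X * (C * (suc p * P))) + suc p * (Y * ((suc c * C) * P))
    regroup = solve-∀
    collect : ∀ c p K → suc c * K + suc p * K ≡ suc (c + suc p) * K
    collect = solve-∀

  multichoose-chain : ∀ c p q →
    multichoose (suc c) p * multichoose (suc c + p) q * (c ! * p ! * q !) ≡ (c + p + q) !
  multichoose-chain c p q = begin
    A * B * (c ! * p ! * q !)       ≡⟨ regroup A B (c !) (p !) (q !) ⟩
    B * (A * (c ! * p !) * q !)     ≡⟨ cong (λ t → B * (t * q !)) (multichoose-fact c p) ⟩
    B * ((c + p) ! * q !)           ≡⟨ multichoose-fact (c + p) q ⟩
    (c + p + q) !                   ∎
    where
    A = multichoose (suc c) p
    B = multichoose (suc c + p) q
    regroup : ∀ A B C P Q → A * B * (C * P * Q) ≡ B * (A * (C * P) * Q)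
    regroup = solve-∀

  -- The order of the two choices is irrelevant; for b = 0 both sides vanish unless p = q = 0.
  multichoose-swap : ∀ b p q → multichoose b p * multichoose (b + p) q ≡ multichoose b q * multichoose (b + q) p
  multichoose-swap zero    zero    zero    = refl
  multichoose-swap zero    zero    (suc q) = refl
  multichoose-swap zero    (suc p) zero    = refl
  multichoose-swap zero    (suc p) (suc q) = refl
  multichoose-swap (suc c) p q = ℕₚ.*-cancelʳ-≡ _ _ (c ! * p ! * q !) {{nonZero}} (begin
    multichoose (suc c) p * multichoose (suc c + p) q * (c ! * p ! * q !)
      ≡⟨ multichoose-chain c p q ⟩
    (c + p + q) !
      ≡⟨ cong _! (swap-summands c p q) ⟩
    (c + q + p) !
      ≡⟨ multichoose-chain c q p ⟨
    multichoose (suc c) q * multichoose (suc c + q) p * (c ! * q ! * p !)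
      ≡⟨ cong (multichoose (suc c) q * multichoose (suc c + q) p *_) (swap-factors (c !) (q !) (p !)) ⟩
    multichoose (suc c) q * multichoose (suc c + q) p * (c ! * p ! * q !)
      ∎)
    where
    nonZero : NonZero (c ! * p ! * q !)
    nonZero = m*n≢0 (c ! * p !) (q !) {{m*n≢0 (c !) (p !) {{c !≢0}} {{p !≢0}}}} {{q !≢0}}
    swap-summands : ∀ x y z → x + y + z ≡ x + z + y
    swap-summands = solve-∀
    swap-factors : ∀ x y z → x * y * z ≡ x * z * y
    swap-factors = solve-∀

  -- The multinomial coefficient as an iterated product of multiset coefficients.
  multichooses : ℕ → List ℕ → ℕ
  multichooses a []      = 1
  multichooses a (x ∷ l) = multichoose (suc a) x * multichooses (a + x) l

  -- This product times a! ∏ j! is (a + Σ j)!, so the division in multinomial is exact.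
  multichooses-fact : ∀ a l → multichooses a l * (a ! * prodFact l) ≡ (a + sumℕ l) !
  multichooses-fact a [] = begin
    1 * (a ! * 1)  ≡⟨ trans (ℕₚ.*-identityˡ _) (ℕₚ.*-identityʳ _) ⟩
    a !            ≡⟨ cong _! (sym (ℕₚ.+-identityʳ a)) ⟩
    (a + 0) !      ∎
  multichooses-fact a (x ∷ l) = begin
    M * T * (a ! * (x ! * prodFact l))     ≡⟨ regroup M T (a !) (x !) (prodFact l) ⟩
    T * (M * (a ! * x !) * prodFact l)     ≡⟨ cong (λ t → T * (t * prodFact l)) (multichoose-fact a x) ⟩
    T * ((a + x) ! * prodFact l)           ≡⟨ multichooses-fact (a + x) l ⟩
    (a + x + sumℕ l) !                     ≡⟨ cong _! (ℕₚ.+-assoc a x (sumℕ l)) ⟩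
    (a + (x + sumℕ l)) !                   ∎
    where
    M = multichoose (suc a) x
    T = multichooses (a + x) l
    regroup : ∀ M T A X P → M * T * (A * (X * P)) ≡ T * (M * (A * X) * P)
    regroup = solve-∀

  multinomial≡multichooses : ∀ a l → multinomial a l ≡ multichooses a l
  multinomial≡multichooses a l =
    trans (/-congˡ (sym (multichooses-fact a l))) (m*n/n≡m (multichooses a l) (a ! * prodFact l))
    where instance _ = m*n≢0 (a !) (prodFact l) {{a !≢0}} {{prodFact-nz l}}

  multinomial-[] : ∀ a → multinomial a [] ≡ 1
  multinomial-[] a = multinomial≡multichooses a []

  multinomial-∷ : ∀ a x l → multinomial a (x ∷ l) ≡ multichoose (suc a) x * multinomial (a + x) l
  multinomial-∷ a x l = trans (multinomial≡multichooses a (x ∷ l))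
                              (cong (multichoose (suc a) x *_) (sym (multinomial≡multichooses (a + x) l)))

module Sums {c ℓ} (R : CommutativeRing c ℓ) where
  open CommutativeRing R
  open import Algebra.Properties.CommutativeSemigroup +-commutativeSemigroup using () renaming (interchange to +-interchange)
  open import Relation.Binary.Reasoning.Setoid setoid
  open import Algebra.Solver.Ring.NaturalCoefficients.Default commutativeSemiring using (solve; _:=_; _:+_; _:*_)

  ∑ : {A : Set} → (A → Carrier) → List A → Carrier
  ∑ f xs = sumR R (map f xs)

  syntax ∑ (λ x → e) xs = ∑[ x ∈ xs ] e

  ∑-congᴬ : {A : Set} {f g : A → Carrier} (xs : List A) → All (λ x → f x ≈ g x) xs → ∑ f xs ≈ ∑ g xs
  ∑-congᴬ []       []         = refl
  ∑-congᴬ (x ∷ xs) (fx≈gx ∷ h) = +-cong fx≈gx (∑-congᴬ xs h)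

  ∑-cong : {A : Set} {f g : A → Carrier} (xs : List A) → (∀ x → f x ≈ g x) → ∑ f xs ≈ ∑ g xs
  ∑-cong xs h = ∑-congᴬ xs (All.universal h xs)

  ∑-zero : {A : Set} {f : A → Carrier} (xs : List A) → All (λ x → f x ≈ 0#) xs → ∑ f xs ≈ 0#
  ∑-zero []       []         = refl
  ∑-zero (x ∷ xs) (fx≈0 ∷ h) = trans (+-cong fx≈0 (∑-zero xs h)) (+-identityʳ 0#)

  ∑-map : {A B : Set} (f : B → Carrier) (g : A → B) (xs : List A) → ∑ f (map g xs) ≡ ∑[ x ∈ xs ] f (g x)
  ∑-map f g xs = Eq.cong (sumR R) (Eq.sym (Listₚ.map-∘ xs))

  ∑-++ : {A : Set} (f : A → Carrier) (xs ys : List A) → ∑ f (xs ++ ys) ≈ ∑ f xs + ∑ f ys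
  ∑-++ f []       ys = sym (+-identityˡ _)
  ∑-++ f (x ∷ xs) ys = trans (+-congˡ (∑-++ f xs ys)) (sym (+-assoc _ _ _))

  ∑-∷ʳ : {A : Set} (f : A → Carrier) (xs : List A) (x : A) → ∑ f (xs ∷ʳ x) ≈ ∑ f xs + f x
  ∑-∷ʳ f xs x = trans (∑-++ f xs [ x ]) (+-congˡ (+-identityʳ (f x)))

  ∑-concatMap : {A B : Set} (f : B → Carrier) (g : A → List B) (xs : List A) →
                ∑ f (concatMap g xs) ≈ ∑[ x ∈ xs ] ∑ f (g x)
  ∑-concatMap f g []       = refl
  ∑-concatMap f g (x ∷ xs) = trans (∑-++ f (g x) (concatMap g xs)) (+-congˡ (∑-concatMap f g xs))

  ∑-+ : {A : Set} (f g : A → Carrier) (xs : List A) → ∑[ x ∈ xs ] (f x + g x) ≈ ∑ f xs + ∑ g xs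
  ∑-+ f g []       = sym (+-identityʳ 0#)
  ∑-+ f g (x ∷ xs) = trans (+-congˡ (∑-+ f g xs)) (+-interchange _ _ _ _)

  ∑-*ˡ : {A : Set} (a : Carrier) (f : A → Carrier) (xs : List A) → a * ∑ f xs ≈ ∑[ x ∈ xs ] (a * f x)
  ∑-*ˡ a f []       = zeroʳ a
  ∑-*ˡ a f (x ∷ xs) = trans (distribˡ a _ _) (+-congˡ (∑-*ˡ a f xs))

  ∑-swap : {A B : Set} (h : A → B → Carrier) (xs : List A) (ys : List B) →
           ∑[ x ∈ xs ] ∑[ y ∈ ys ] h x y ≈ ∑[ y ∈ ys ] ∑[ x ∈ xs ] h x y
  ∑-swap h []       ys = sym (∑-zero ys (All.universal (λ _ → refl) ys))
  ∑-swap h (x ∷ xs) ys = trans (+-congˡ (∑-swap h xs ys)) (sym (∑-+ (h x) _ ys))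

  ∑-upTo-suc : (f : ℕ → Carrier) (m : ℕ) → ∑ f (upTo (suc m)) ≈ ∑ f (upTo m) + f m
  ∑-upTo-suc f m = trans (reflexive (Eq.cong (∑ f) (Eq.sym (Listₚ.upTo-∷ʳ m)))) (∑-∷ʳ f (upTo m) m)

  summation-by-parts : (a b g : ℕ → Carrier) → a 0 ≈ b 0 → (∀ i → a (suc i) ≈ b (suc i) + a i) → ∀ m →
    ∑[ i ∈ upTo (suc m) ] (a i * g i) + a m * g (suc m)
      ≈ ∑[ i ∈ upTo (suc m) ] (b i * g i) + ∑[ i ∈ upTo (suc m) ] (a i * g (suc i))
  summation-by-parts a b g a₀ aₛ zero = +-cong (+-congʳ (*-congʳ a₀)) (sym (+-identityʳ _))
  summation-by-parts a b g a₀ aₛ (suc m) = begin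
    ∑[ i ∈ upTo (suc (suc m)) ] (a i * g i) + a (suc m) * g (suc (suc m))
      ≈⟨ +-congʳ (∑-upTo-suc (λ i → a i * g i) (suc m)) ⟩
    (A + a (suc m) * g (suc m)) + a (suc m) * g (suc (suc m))
      ≈⟨ +-congʳ (+-congˡ (*-congʳ (aₛ m))) ⟩
    (A + (b (suc m) + a m) * g (suc m)) + a (suc m) * g (suc (suc m))
      ≈⟨ +-congʳ (regroup A (a m) (b (suc m)) (g (suc m))) ⟩
    ((A + a m * g (suc m)) + b (suc m) * g (suc m)) + a (suc m) * g (suc (suc m))
      ≈⟨ +-congʳ (+-congʳ (summation-by-parts a b g a₀ aₛ m)) ⟩
    ((B + D) + b (suc m) * g (suc m)) + a (suc m) * g (suc (suc m))
      ≈⟨ trans (+-assoc _ _ _) (+-interchange B D _ _) ⟩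
    (B + b (suc m) * g (suc m)) + (D + a (suc m) * g (suc (suc m)))
      ≈⟨ +-cong (∑-upTo-suc (λ i → b i * g i) (suc m)) (∑-upTo-suc (λ i → a i * g (suc i)) (suc m)) ⟨
    ∑[ i ∈ upTo (suc (suc m)) ] (b i * g i) + ∑[ i ∈ upTo (suc (suc m)) ] (a i * g (suc i))
      ∎
    where
    A = ∑[ i ∈ upTo (suc m) ] (a i * g i)
    B = ∑[ i ∈ upTo (suc m) ] (b i * g i)
    D = ∑[ i ∈ upTo (suc m) ] (a i * g (suc i))
    regroup : ∀ A x y u → A + (y + x) * u ≈ (A + x * u) + y * u
    regroup = solve 4 (λ A x y u → A :+ (y :+ x) :* u := (A :+ x :* u) :+ y :* u) refl

module Identity {c ℓ} (R : CommutativeRing c ℓ) {n : ℕ}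
                (z : Fin n → CommutativeRing.Carrier R) (s : Fin n → ℕ) where
  open CommutativeRing R
  open Sums R
  open Multichoose
  open Data.Nat using () renaming (_+_ to _+ℕ_; _*_ to _*ℕ_)
  open import Algebra.Properties.Semiring.Mult semiring using (_×_; ×1-homo-*; ×-homo-+; ×-homo-1)
  open import Algebra.Properties.Group +-group using (∙-cancelˡ)
  open import Algebra.Properties.CommutativeSemigroup *-commutativeSemigroup using (x∙yz≈y∙xz)
  open import Algebra.Properties.CommutativeSemigroup +-commutativeSemigroup using () renaming (x∙yz≈y∙xz to +-x∙yz≈y∙xz)
  open import Relation.Binary.Reasoning.Setoid setoid
  open import Algebra.Solver.Ring.NaturalCoefficients.Default commutativeSemiring using (solve; _:=_; _:+_; _:*_)

  infixr 8 _^_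
  _^_ : Carrier → ℕ → Carrier
  x ^ k = pow R x k

  ι : ℕ → Carrier
  ι m = m × 1#

  ι-+ : ∀ m k → ι (m +ℕ k) ≈ ι m + ι k
  ι-+ = ×-homo-+ 1#

  ι-* : ∀ m k → ι (m *ℕ k) ≈ ι m * ι k
  ι-* = ×1-homo-*

  ι-1 : ι 1 ≈ 1#
  ι-1 = ×-homo-1 1#

  ι-multichoose-pascal : ∀ b i →
    ι (multichoose (suc b) (suc i)) ≈ ι (multichoose b (suc i)) + ι (multichoose (suc b) i)
  ι-multichoose-pascal b i = ι-+ (multichoose b (suc i)) (multichoose (suc b) i)

  ι-multichoose-swap : ∀ b p q →
    ι (multichoose b p) * ι (multichoose (b +ℕ p) q) ≈ ι (multichoose b q) * ι (multichoose (b +ℕ q) p)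
  ι-multichoose-swap b p q =
    trans (sym (ι-* (multichoose b p) (multichoose (b +ℕ p) q)))
          (trans (reflexive (Eq.cong ι (multichoose-swap b p q))) (ι-* (multichoose b q) (multichoose (b +ℕ q) p)))

  -- L ∖ k; others k in the theorem is rem k (allFin n).
  rem : Fin n → List (Fin n) → List (Fin n)
  rem k = filter (λ i → ¬? (i ≟ k))

  rem-fresh : ∀ r L → All (r ≢_) L → rem r (r ∷ L) ≡ L
  rem-fresh r L r∉L = Eq.trans (Listₚ.filter-reject (λ i → ¬? (i ≟ r)) (λ r≢r → r≢r Eq.refl))
                               (Listₚ.filter-all (λ i → ¬? (i ≟ r)) (All.map (λ r≢i i≡r → r≢i (Eq.sym i≡r)) r∉L))

  rem-other : ∀ k r L → r ≢ k → rem k (r ∷ L) ≡ r ∷ rem k L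
  rem-other k r L r≢k = Listₚ.filter-accept (λ i → ¬? (i ≟ k)) r≢k

  -- H L b = Σ_{j ≤ s on L} (coefficient of z^j in (1 - y_L)^(-b)) · z^j, expanded
  -- along the first index of L.
  H : List (Fin n) → ℕ → Carrier
  H []      b = 1#
  H (r ∷ L) b = ∑[ i ∈ upTo (suc (s r)) ] (ι (multichoose b i) * (z r ^ i * H L (b +ℕ i)))

  -- The overflow terms of y_L · H L b.
  S : List (Fin n) → ℕ → Carrier
  S L b = ∑[ k ∈ L ] (z k ^ suc (s k) * (ι (multichoose b (s k)) * H (rem k L) (b +ℕ s k)))

  -- (1 - y)^0 = 1: every non-constant coefficient of H L 0 vanishes.
  H-zero : ∀ L → H L 0 ≈ 1#
  H-zero []      = refl
  H-zero (r ∷ L) = trans (+-cong constant-term higher-terms) (+-identityʳ 1#)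
    where
    constant-term : ι 1 * (1# * H L 0) ≈ 1#
    constant-term = trans (*-cong ι-1 (*-identityˡ _)) (trans (*-identityˡ _) (H-zero L))
    higher-terms : ∑[ i ∈ applyUpTo suc (s r) ] (ι (multichoose 0 i) * (z r ^ i * H L i)) ≈ 0#
    higher-terms = ∑-zero _ (Allₚ.applyUpTo⁺₂ _ (s r) (λ i → zeroˡ _))

  -- Summation by parts in the exponent of z_r: the overflow term of r plus
  -- Σ_i ((b+1 multichoose i)) z_r^i H_L(b+i) equals H (r ∷ L) b + z_r · H (r ∷ L) (b+1).
  H-pascal : ∀ r L b →
    z r ^ suc (s r) * (ι (multichoose (suc b) (s r)) * H L (suc b +ℕ s r))
      + ∑[ i ∈ upTo (suc (s r)) ] (ι (multichoose (suc b) i) * (z r ^ i * H L (b +ℕ i)))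
    ≈ H (r ∷ L) b + z r * H (r ∷ L) (suc b)
  H-pascal r L b = begin
    w ^ suc m * (a m * H L (suc b +ℕ m)) + ∑[ i ∈ I ] (a i * g i)
      ≈⟨ +-comm _ _ ⟩
    ∑[ i ∈ I ] (a i * g i) + w ^ suc m * (a m * H L (suc b +ℕ m))
      ≈⟨ +-congˡ top-term ⟩
    ∑[ i ∈ I ] (a i * g i) + a m * g (suc m)
      ≈⟨ summation-by-parts a a′ g a₀ (ι-multichoose-pascal b) m ⟩
    ∑[ i ∈ I ] (a′ i * g i) + ∑[ i ∈ I ] (a i * g (suc i))
      ≈⟨ +-congˡ shifted ⟩
    H (r ∷ L) b + w * H (r ∷ L) (suc b)
      ∎
    where
    w = z r
    m = s r
    I = upTo (suc m)
    a a′ : ℕ → Carrier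
    a  i = ι (multichoose (suc b) i)
    a′ i = ι (multichoose b i)
    g : ℕ → Carrier
    g i = w ^ i * H L (b +ℕ i)
    a₀ : a 0 ≈ a′ 0
    a₀ = reflexive (Eq.cong ι (Eq.sym (multichoose-zeroʳ b)))
    shift : ∀ i → H L (b +ℕ suc i) ≡ H L (suc b +ℕ i)
    shift i = Eq.cong (H L) (ℕₚ.+-suc b i)
    top-term : w ^ suc m * (a m * H L (suc b +ℕ m)) ≈ a m * g (suc m)
    top-term = trans (x∙yz≈y∙xz _ _ _) (*-congˡ (*-congˡ (reflexive (Eq.sym (shift m)))))
    shifted : ∑[ i ∈ I ] (a i * g (suc i)) ≈ w * H (r ∷ L) (suc b)
    shifted = trans (∑-cong I (λ i → trans (*-congˡ (*-congˡ (reflexive (shift i)))) (pull-out _ _ _ _)))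
                    (sym (∑-*ˡ w _ I))
      where
      pull-out : ∀ x y u v → x * ((y * u) * v) ≈ y * (x * (u * v))
      pull-out = solve 4 (λ x y u v → x :* ((y :* u) :* v) := y :* (x :* (u :* v))) refl

  -- For k ≠ r, the overflow term of k in r ∷ L, expanded along r with the
  -- multiset coefficients swapped so that the exponent of z_r comes first.
  S-term-expand : ∀ r L b k → r ≢ k →
    z k ^ suc (s k) * (ι (multichoose b (s k)) * H (rem k (r ∷ L)) (b +ℕ s k))
    ≈ ∑[ i ∈ upTo (suc (s r)) ] (ι (multichoose b i) * (z r ^ i *
         (z k ^ suc (s k) * (ι (multichoose (b +ℕ i) (s k)) * H (rem k L) (b +ℕ i +ℕ s k)))))
  S-term-expand r L b k r≢k = begin
    P * (β * H (rem k (r ∷ L)) (b +ℕ s k))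
      ≡⟨ Eq.cong (λ M → P * (β * H M (b +ℕ s k))) (rem-other k r L r≢k) ⟩
    P * (β * ∑[ i ∈ I ] (γ i * (z r ^ i * h (b +ℕ s k +ℕ i))))
      ≈⟨ trans (*-congˡ (∑-*ˡ β _ I)) (∑-*ˡ P _ I) ⟩
    ∑[ i ∈ I ] (P * (β * (γ i * (z r ^ i * h (b +ℕ s k +ℕ i)))))
      ≈⟨ ∑-cong I term ⟩
    ∑[ i ∈ I ] (ι (multichoose b i) * (z r ^ i * (P * (ι (multichoose (b +ℕ i) (s k)) * h (b +ℕ i +ℕ s k)))))
      ∎
    where
    P = z k ^ suc (s k)
    β = ι (multichoose b (s k))
    γ : ℕ → Carrier
    γ i = ι (multichoose (b +ℕ s k) i)
    h = H (rem k L)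
    I = upTo (suc (s r))
    gather : ∀ p x y u v → p * (x * (y * (u * v))) ≈ (x * y) * (u * (p * v))
    gather = solve 5 (λ p x y u v → p :* (x :* (y :* (u :* v))) := (x :* y) :* (u :* (p :* v))) refl
    scatter : ∀ x y u p v → (x * y) * (u * (p * v)) ≈ x * (u * (p * (y * v)))
    scatter = solve 5 (λ x y u p v → (x :* y) :* (u :* (p :* v)) := x :* (u :* (p :* (y :* v)))) refl
    reindex : ∀ b p i → b +ℕ p +ℕ i ≡ b +ℕ i +ℕ p
    reindex = solve-∀
    term : ∀ i → P * (β * (γ i * (z r ^ i * h (b +ℕ s k +ℕ i))))
               ≈ ι (multichoose b i) * (z r ^ i * (P * (ι (multichoose (b +ℕ i) (s k)) * h (b +ℕ i +ℕ s k))))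
    term i = begin
      P * (β * (γ i * (z r ^ i * h (b +ℕ s k +ℕ i))))
        ≈⟨ gather _ _ _ _ _ ⟩
      (β * γ i) * (z r ^ i * (P * h (b +ℕ s k +ℕ i)))
        ≈⟨ *-cong (ι-multichoose-swap b (s k) i) (*-congˡ (*-congˡ (reflexive (Eq.cong h (reindex b (s k) i))))) ⟩
      (ι (multichoose b i) * ι (multichoose (b +ℕ i) (s k))) * (z r ^ i * (P * h (b +ℕ i +ℕ s k)))
        ≈⟨ scatter _ _ _ _ _ ⟩
      ι (multichoose b i) * (z r ^ i * (P * (ι (multichoose (b +ℕ i) (s k)) * h (b +ℕ i +ℕ s k))))
        ∎

  S-expand : ∀ r L b → All (r ≢_) L →
    ∑[ k ∈ L ] (z k ^ suc (s k) * (ι (multichoose b (s k)) * H (rem k (r ∷ L)) (b +ℕ s k)))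
    ≈ ∑[ i ∈ upTo (suc (s r)) ] (ι (multichoose b i) * (z r ^ i * S L (b +ℕ i)))
  S-expand r L b r∉L = begin
    ∑[ k ∈ L ] (z k ^ suc (s k) * (ι (multichoose b (s k)) * H (rem k (r ∷ L)) (b +ℕ s k)))
      ≈⟨ ∑-congᴬ L (All.map (S-term-expand r L b _) r∉L) ⟩
    ∑[ k ∈ L ] ∑[ i ∈ I ] (ι (multichoose b i) * (z r ^ i * T k i))
      ≈⟨ ∑-swap (λ k i → ι (multichoose b i) * (z r ^ i * T k i)) L I ⟩
    ∑[ i ∈ I ] ∑[ k ∈ L ] (ι (multichoose b i) * (z r ^ i * T k i))
      ≈⟨ ∑-cong I (λ i → sym (trans (*-congˡ (∑-*ˡ (z r ^ i) (λ k → T k i) L)) (∑-*ˡ (ι (multichoose b i)) _ L))) ⟩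
    ∑[ i ∈ I ] (ι (multichoose b i) * (z r ^ i * S L (b +ℕ i)))
      ∎
    where
    I = upTo (suc (s r))
    T : Fin n → ℕ → Carrier
    T k i = z k ^ suc (s k) * (ι (multichoose (b +ℕ i) (s k)) * H (rem k L) (b +ℕ i +ℕ s k))

  Balanced : List (Fin n) → Set ℓ
  Balanced L = ∀ b → H L (suc b) + S L (suc b) ≈ H L b + sumR R (map z L) * H L (suc b)

  -- Inductive step, on the part of r ∷ L expanded along r: summing (balanced) for L
  -- against the weights of r.
  balanced-step : ∀ r L b → Balanced L →
    H (r ∷ L) (suc b) + ∑[ i ∈ upTo (suc (s r)) ] (ι (multichoose (suc b) i) * (z r ^ i * S L (suc b +ℕ i)))
    ≈ ∑[ i ∈ upTo (suc (s r)) ] (ι (multichoose (suc b) i) * (z r ^ i * H L (b +ℕ i)))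
      + sumR R (map z L) * H (r ∷ L) (suc b)
  balanced-step r L b balanced = begin
    ∑[ i ∈ I ] (a i * (z r ^ i * H L (suc b +ℕ i))) + ∑[ i ∈ I ] (a i * (z r ^ i * S L (suc b +ℕ i)))
      ≈⟨ ∑-+ _ _ I ⟨
    ∑[ i ∈ I ] (a i * (z r ^ i * H L (suc b +ℕ i)) + a i * (z r ^ i * S L (suc b +ℕ i)))
      ≈⟨ ∑-cong I (λ i → trans (factor _ _ _ _) (*-congˡ (*-congˡ (balanced (b +ℕ i))))) ⟩
    ∑[ i ∈ I ] (a i * (z r ^ i * (H L (b +ℕ i) + y * H L (suc b +ℕ i))))
      ≈⟨ ∑-cong I (λ i → expand _ _ _ y _) ⟩
    ∑[ i ∈ I ] (a i * (z r ^ i * H L (b +ℕ i)) + y * (a i * (z r ^ i * H L (suc b +ℕ i))))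
      ≈⟨ ∑-+ _ _ I ⟩
    ∑[ i ∈ I ] (a i * (z r ^ i * H L (b +ℕ i))) + ∑[ i ∈ I ] (y * (a i * (z r ^ i * H L (suc b +ℕ i))))
      ≈⟨ +-congˡ (∑-*ˡ y _ I) ⟨
    ∑[ i ∈ I ] (a i * (z r ^ i * H L (b +ℕ i))) + y * H (r ∷ L) (suc b)
      ∎
    where
    I = upTo (suc (s r))
    y = sumR R (map z L)
    a : ℕ → Carrier
    a i = ι (multichoose (suc b) i)
    factor : ∀ x p u v → x * (p * u) + x * (p * v) ≈ x * (p * (u + v))
    factor = solve 4 (λ x p u v → x :* (p :* u) :+ x :* (p :* v) := x :* (p :* (u :+ v))) refl
    expand : ∀ x p u y v → x * (p * (u + y * v)) ≈ x * (p * u) + y * (x * (p * v))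
    expand = solve 5 (λ x p u y v → x :* (p :* (u :+ y :* v)) := x :* (p :* u) :+ y :* (x :* (p :* v))) refl

  balanced : ∀ L → Unique L → Balanced L
  balanced []      []           b = +-congˡ (sym (zeroˡ 1#))
  balanced (r ∷ L) (r∉L ∷ uniq) b = begin
    A + (top + ∑[ k ∈ L ] (z k ^ suc (s k) * (ι (multichoose (suc b) (s k)) * H (rem k (r ∷ L)) (suc b +ℕ s k))))
      ≈⟨ +-congˡ (+-cong (reflexive (Eq.cong (λ M → z r ^ suc (s r) * (ι (multichoose (suc b) (s r)) * H M (suc b +ℕ s r))) (rem-fresh r L r∉L)))
                         (S-expand r L (suc b) r∉L)) ⟩
    A + (top′ + ∑[ i ∈ I ] (ι (multichoose (suc b) i) * (z r ^ i * S L (suc b +ℕ i))))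
      ≈⟨ +-x∙yz≈y∙xz A top′ _ ⟩
    top′ + (A + ∑[ i ∈ I ] (ι (multichoose (suc b) i) * (z r ^ i * S L (suc b +ℕ i))))
      ≈⟨ +-congˡ (balanced-step r L b (balanced L uniq)) ⟩
    top′ + (∑[ i ∈ I ] (ι (multichoose (suc b) i) * (z r ^ i * H L (b +ℕ i))) + y * A)
      ≈⟨ +-assoc _ _ _ ⟨
    (top′ + ∑[ i ∈ I ] (ι (multichoose (suc b) i) * (z r ^ i * H L (b +ℕ i)))) + y * A
      ≈⟨ +-congʳ (H-pascal r L b) ⟩
    (H (r ∷ L) b + z r * A) + y * A
      ≈⟨ trans (+-congˡ (distribʳ A (z r) y)) (sym (+-assoc _ _ _)) ⟨
    H (r ∷ L) b + (z r + y) * A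
      ∎
    where
    I = upTo (suc (s r))
    y = sumR R (map z L)
    A = H (r ∷ L) (suc b)
    top = z r ^ suc (s r) * (ι (multichoose (suc b) (s r)) * H (rem r (r ∷ L)) (suc b +ℕ s r))
    top′ = z r ^ suc (s r) * (ι (multichoose (suc b) (s r)) * H L (suc b +ℕ s r))

  update-here : ∀ (j : Fin n → ℕ) i x → update j i x i ≡ x
  update-here j i x with i ≟ i
  ... | yes _   = Eq.refl
  ... | no i≢i = ⊥-elim (i≢i Eq.refl)

  update-there : ∀ (j : Fin n → ℕ) i x l → l ≢ i → update j i x l ≡ j l
  update-there j i x l l≢i with l ≟ i
  ... | yes l≡i = ⊥-elim (l≢i l≡i)
  ... | no _    = Eq.refl

  term : ℕ → List (Fin n) → (Fin n → ℕ) → Carrier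
  term a L j = ι (multinomial a (map j L)) * prodR R (map (λ i → z i ^ j i) L)

  term-update : ∀ a i L j x → All (i ≢_) L →
    term a (i ∷ L) (update j i x) ≈ ι (multichoose (suc a) x) * (z i ^ x * term (a +ℕ x) L j)
  term-update a i L j x i∉L = begin
    ι (multinomial a (u i ∷ map u L)) * (z i ^ u i * prodR R (map (λ l → z l ^ u l) L))
      ≡⟨ Eq.cong₂ (λ v p → ι (multinomial a v) * p) (Eq.cong₂ _∷_ (update-here j i x) same-exponents)
                  (Eq.cong₂ (λ e q → z i ^ e * prodR R q) (update-here j i x) same-powers) ⟩
    ι (multinomial a (x ∷ map j L)) * (z i ^ x * P)
      ≈⟨ *-congʳ (reflexive (Eq.cong ι (multinomial-∷ a x (map j L)))) ⟩
    ι (multichoose (suc a) x *ℕ multinomial (a +ℕ x) (map j L)) * (z i ^ x * P)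
      ≈⟨ *-congʳ (ι-* (multichoose (suc a) x) (multinomial (a +ℕ x) (map j L))) ⟩
    (ι (multichoose (suc a) x) * ι (multinomial (a +ℕ x) (map j L))) * (z i ^ x * P)
      ≈⟨ regroup _ _ _ _ ⟩
    ι (multichoose (suc a) x) * (z i ^ x * term (a +ℕ x) L j)
      ∎
    where
    u = update j i x
    P = prodR R (map (λ l → z l ^ j l) L)
    untouched : All (λ l → u l ≡ j l) L
    untouched = All.map (λ i≢l → update-there j i x _ (λ l≡i → i≢l (Eq.sym l≡i))) i∉L
    same-exponents : map u L ≡ map j L
    same-exponents = Listₚ.map-cong-local untouched
    same-powers : map (λ l → z l ^ u l) L ≡ map (λ l → z l ^ j l) L
    same-powers = Listₚ.map-cong-local (All.map (Eq.cong (z _ ^_)) untouched)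
    regroup : ∀ c m p q → (c * m) * (p * q) ≈ c * (p * (m * q))
    regroup = solve 4 (λ c m p q → (c :* m) :* (p :* q) := c :* (p :* (m :* q))) refl

  tuples-sum : ∀ L → Unique L → ∀ a → ∑ (term a L) (tuples s L) ≈ H L (suc a)
  tuples-sum []      []           a = trans (+-identityʳ _)
    (trans (*-identityʳ _) (trans (reflexive (Eq.cong ι (multinomial-[] a))) ι-1))
  tuples-sum (i ∷ L) (i∉L ∷ uniq) a = begin
    ∑ (term a (i ∷ L)) (tuples s (i ∷ L))
      ≈⟨ ∑-concatMap (term a (i ∷ L)) (λ j → map (update j i) X) (tuples s L) ⟩
    ∑[ j ∈ tuples s L ] ∑ (term a (i ∷ L)) (map (update j i) X)
      ≈⟨ ∑-cong (tuples s L) (λ j → reflexive (∑-map (term a (i ∷ L)) (update j i) X)) ⟩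
    ∑[ j ∈ tuples s L ] ∑[ x ∈ X ] term a (i ∷ L) (update j i x)
      ≈⟨ ∑-cong (tuples s L) (λ j → ∑-cong X (λ x → term-update a i L j x i∉L)) ⟩
    ∑[ j ∈ tuples s L ] ∑[ x ∈ X ] (α x * (z i ^ x * term (a +ℕ x) L j))
      ≈⟨ ∑-swap _ (tuples s L) X ⟩
    ∑[ x ∈ X ] ∑[ j ∈ tuples s L ] (α x * (z i ^ x * term (a +ℕ x) L j))
      ≈⟨ ∑-cong X (λ x → sym (trans (*-congˡ (∑-*ˡ (z i ^ x) _ (tuples s L))) (∑-*ˡ (α x) _ (tuples s L)))) ⟩
    ∑[ x ∈ X ] (α x * (z i ^ x * ∑ (term (a +ℕ x) L) (tuples s L)))
      ≈⟨ ∑-cong X (λ x → *-congˡ (*-congˡ (tuples-sum L uniq (a +ℕ x)))) ⟩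
    H (i ∷ L) (suc a)
      ∎
    where
    X = upTo (suc (s i))
    α : ℕ → Carrier
    α x = ι (multichoose (suc a) x)

  lhs≈S : lhs R z s ≈ S (allFin n) 1
  lhs≈S = ∑-cong (allFin n) (λ k → *-congˡ (trans (tuples-sum (others k) (unique-others k) (s k)) (sym (unit-coefficient k))))
    where
    unique-others : ∀ k → Unique (others k)
    unique-others k = Uniqueₚ.filter⁺ (λ i → ¬? (i ≟ k)) (Uniqueₚ.allFin⁺ n)
    unit-coefficient : ∀ k → ι (multichoose 1 (s k)) * H (others k) (suc (s k)) ≈ H (others k) (suc (s k))
    unit-coefficient k = trans (*-congʳ (trans (reflexive (Eq.cong ι (multichoose-one (s k)))) ι-1)) (*-identityˡ _)

  -- (balanced) at b = 0 with y = 1 reads H + S ≈ 1 + H.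
  identity : sumR R (map z (allFin n)) ≈ 1# → lhs R z s ≈ 1#
  identity Σz≈1 = trans lhs≈S (∙-cancelˡ (H L 1) _ _ (begin
    H L 1 + S L 1                               ≈⟨ balanced L (Uniqueₚ.allFin⁺ n) 0 ⟩
    H L 0 + sumR R (map z L) * H L 1            ≈⟨ +-cong (H-zero L) (trans (*-congʳ Σz≈1) (*-identityˡ _)) ⟩
    1# + H L 1                                  ≈⟨ +-comm _ _ ⟩
    H L 1 + 1#                                  ∎))
    where
    L = allFin n

-- The theorem, in any commutative ring.
theorem6 : ∀ {c ℓ} (R : CommutativeRing c ℓ) (n : ℕ) → 1 ≤ n →
           (z : Fin n → CommutativeRing.Carrier R) →
           CommutativeRing._≈_ R (sumR R (map z (allFin n))) (CommutativeRing.1# R) →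
           (s : Fin n → ℕ) →
           CommutativeRing._≈_ R (lhs R z s) (CommutativeRing.1# R)
theorem6 R n _ z Σz≈1 s = Identity.identity R z s Σz≈1
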